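{- Let $G=(V,E)$ be a distance-regular graph of diameter $d\geqslant 3$ with intersection numbers $a_i,b_i,c_i$. Then $G$ is a Deza graph if and only if one of the following holds: (i) $a_1=0$; in this case $G$ is a Deza graph with parameters $(n,k,c_2,0)$ whose children are $(V,E_2)$ and its complement; (ii) $a_1=c_2$; in this case $G$ is a Deza graph with parameters $(n,k,c_2,0)$ whose children are $(V,E_1\cup E_2)$ and its complement.
   Context: A connected graph $G=(V,E)$ of order $n$ and diameter $d$ is distance-regular if there are numbers $a_i,b_i,c_i$ ($0\le i\le d$) such that for all $x,y\in V$ at distance $i$, the number of neighbours of $y$ at distance $i+1$, $i$, $i-1$ from $x$ equals $b_i$, $a_i$, $c_i$ respectively; then $G$ is $k$-regular with $k=b_0$. For $i\ge 1$, $E_i$ denotes the set of pairs of vertices at distance exactly $i$ (so $E_1=E$). A Deza graph with parameters $(n,k,b,a)$, $b\geqslant a$, is a $k$-regular graph on $n$ vertices, neither complete nor edgeless, in which any two distinct vertices have exactly $b$ or exactly $a$ common neighbours. For $b>a$ its children are $G_A$ (two distinct vertices adjacent iff they have $a$ common neighbours) and $G_B$ (adjacent iff they have $b$ common neighbours). -}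

module Defs where

open import Data.Nat using (ℕ; zero; suc; _≤_)
open import Data.Fin using (Fin; _≟_)
open import Data.Bool using (Bool; true; false; _∧_; _∨_; not; if_then_else_)
open import Data.List using (List; allFin; map)
open import Data.Nat.ListAction using (sum)
open import Data.Bool.ListAction using (any)
open import Data.Product using (Σ; _×_; ∃)
open import Data.Sum using (_⊎_)
open import Relation.Nullary using (¬_)
open import Relation.Nullary.Decidable using (isYes)
open import Relation.Binary.PropositionalEquality using (_≡_; _≢_)
open import Function.Bundles using (_⇔_)

record Graph : Set where
  field
    n     : ℕ
    adj   : Fin n → Fin n → Bool
    sym   : ∀ x y → adj x y ≡ adj y x
    loopless : ∀ x → adj x x ≡ false
open Graph public

count : ∀ {n} → (Fin n → Bool) → ℕ
count {n} p = sum (map (λ z → if p z then 1 else 0) (allFin n))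

module _ (G : Graph) where
  V : Set
  V = Fin (n G)

  within : ℕ → V → V → Bool
  within zero x y = isYes (x ≟ y)
  within (suc m) x y = within m x y ∨ any (λ z → within m x z ∧ adj G z y) (allFin (n G))

  atDist : ℕ → V → V → Bool
  atDist zero x y = within zero x y
  atDist (suc i) x y = within (suc i) x y ∧ not (within i x y)

  ConnectedDiameter : ℕ → Set
  ConnectedDiameter d = (∀ x y → within d x y ≡ true)
                      × Σ V (λ x → Σ V (λ y → atDist d x y ≡ true))

  -- G is distance-regular of diameter d with intersection numbers a i, b i, c i
  -- (c 0 = 0 by convention; b d = 0 is forced by the diameter).
  IsDRG : ℕ → (ℕ → ℕ) → (ℕ → ℕ) → (ℕ → ℕ) → Set
  IsDRG d a b c =
      ConnectedDiameter d
    × (∀ i x y → i ≤ d → atDist i x y ≡ true →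
          (count (λ z → adj G y z ∧ atDist (suc i) x z) ≡ b i)
        × (count (λ z → adj G y z ∧ atDist i x z) ≡ a i))
    × (∀ i x y → suc i ≤ d → atDist (suc i) x y ≡ true →
          count (λ z → adj G y z ∧ atDist i x z) ≡ c (suc i))
    × c 0 ≡ 0

  degree : V → ℕ
  degree x = count (adj G x)

  commonNbrs : V → V → ℕ
  commonNbrs x y = count (λ z → adj G x z ∧ adj G y z)

  Complete : Set
  Complete = ∀ x y → x ≢ y → adj G x y ≡ true

  Edgeless : Set
  Edgeless = ∀ x y → adj G x y ≡ false

  IsDeza : ℕ → ℕ → ℕ → Set
  IsDeza k b a =
      a ≤ b
    × (∀ x → degree x ≡ k)
    × ¬ Complete
    × ¬ Edgeless
    × (∀ x y → x ≢ y → commonNbrs x y ≡ b ⊎ commonNbrs x y ≡ a)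

  IsDezaGraph : Set
  IsDezaGraph = Σ ℕ λ k → Σ ℕ λ b → Σ ℕ λ a → IsDeza k b a

  -- child relation: distinct vertices with exactly m common neighbours
  -- (G_B for m = b, G_A for m = a)
  Child : ℕ → V → V → Set
  Child m x y = x ≢ y × commonNbrs x y ≡ m

  SameRel : (V → V → Set) → (V → V → Set) → Set
  SameRel R S = ∀ x y → R x y ⇔ S x y

  E2 : V → V → Set
  E2 x y = atDist 2 x y ≡ true

  E12 : V → V → Set
  E12 x y = adj G x y ≡ true ⊎ atDist 2 x y ≡ true

  Compl : (V → V → Set) → V → V → Set
  Compl R x y = x ≢ y × ¬ R x y

{-# OPTIONS --safe #-}
-- In a distance-regular graph of diameter at least 2, two distinct vertices have a₁ common
-- neighbours when adjacent, c₂ ≠ 0 when at distance 2, and none otherwise. If a₁ = 0 or a₁ = c₂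
-- only the two values c₂ and 0 occur, and the pairs with c₂ common neighbours are exactly E₂,
-- resp. E₁ ∪ E₂. Conversely, diameter at least 3 makes all three values a₁, c₂, 0 occur, while a
-- Deza graph allows only two; as c₂ ≠ 0, this forces a₁ ∈ {0, c₂}.
module Submission where

open import Defs hiding (sym)
open import Data.Nat using (ℕ; _≤_; suc; z≤n; s≤s)
open import Data.Nat.Properties using (m≤n⇒m<n∨m≡n; <⇒≤)
open import Data.Nat.ListAction using (sum)
open import Data.Bool using (Bool; true; false; _∧_; _∨_; not; if_then_else_)
open import Data.Bool.Properties
  using (∧-conicalˡ; ∧-conicalʳ; ∧-comm; ∧-idem; ∨-zeroʳ; not-injective; ¬-not; T-≡)
open import Data.Bool.ListAction using (any)
open import Data.Fin using (Fin; _≟_)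
open import Data.List using (List; []; _∷_; map; allFin)
open import Data.List.Properties using (map-cong)
open import Data.List.Relation.Unary.Any using (here; there; satisfied)
open import Data.List.Relation.Unary.Any.Properties using (any⁺; any⁻)
open import Data.List.Membership.Propositional using (_∈_; lose)
open import Data.List.Membership.Propositional.Properties using (∈-allFin)
open import Data.Product using (Σ; _×_; _,_; proj₁; proj₂)
open import Data.Sum using (_⊎_; inj₁; inj₂; [_,_])
open import Function using (_∘_; case_of_; _⇔_; mk⇔)
open import Function.Bundles using (Equivalence)
open import Relation.Nullary using (¬_; contradiction)
open import Relation.Nullary.Decidable using (isYes≗does; dec-true; toWitness)
open import Relation.Binary.PropositionalEquality
  using (_≡_; _≢_; refl; sym; trans; cong; cong₂)

private
  variable
    A : Set

true≢false : true ≢ false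
true≢false ()

∧≡true⇒both : {u v : Bool} → u ∧ v ≡ true → u ≡ true × v ≡ true
∧≡true⇒both {u} {v} e = ∧-conicalˡ u v e , ∧-conicalʳ u v e

any-intro : {p : A → Bool} {xs : List A} {z : A} → z ∈ xs → p z ≡ true → any p xs ≡ true
any-intro {p = p} z∈xs pz = Equivalence.to T-≡ (any⁺ p (lose z∈xs (Equivalence.from T-≡ pz)))

any-elim : {p : A → Bool} (xs : List A) → any p xs ≡ true → Σ A (λ z → p z ≡ true)
any-elim {p = p} xs e with z , pz ← satisfied (any⁻ p xs (Equivalence.from T-≡ e)) =
  z , Equivalence.to T-≡ pz

indicator : Bool → ℕ
indicator u = if u then 1 else 0

sum-indicator-zero : {p : A → Bool} (xs : List A) → (∀ z → p z ≡ false) →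
                     sum (map (indicator ∘ p) xs) ≡ 0
sum-indicator-zero []       _ = refl
sum-indicator-zero (x ∷ xs) h rewrite h x = sum-indicator-zero xs h

sum-indicator-pos : {p : A → Bool} {xs : List A} {z : A} → z ∈ xs → p z ≡ true →
                    sum (map (indicator ∘ p) xs) ≢ 0
sum-indicator-pos (here refl) pz rewrite pz = λ ()
sum-indicator-pos {p = p} (there {x = x} z∈xs) pz with p x
... | true  = λ ()
... | false = sum-indicator-pos z∈xs pz

module _ {n : ℕ} where
  private
    variable
      p q : Fin n → Bool

  count-cong : (∀ z → p z ≡ q z) → count p ≡ count q
  count-cong h = cong sum (map-cong (cong indicator ∘ h) (allFin n))

  count-zero : (∀ z → p z ≡ false) → count p ≡ 0
  count-zero = sum-indicator-zero (allFin n)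

  count≢0 : ∀ z → p z ≡ true → count p ≢ 0
  count≢0 z = sum-indicator-pos (∈-allFin z)

module _ (G : Graph) where
  private
    variable
      i j : ℕ
      x y z : V G

  adj⇒≢ : adj G x y ≡ true → x ≢ y
  adj⇒≢ {x} e refl = true≢false (trans (sym e) (loopless G x))

  within-0⇒≡ : within G 0 x y ≡ true → x ≡ y
  within-0⇒≡ e = toWitness (Equivalence.from T-≡ e)

  within-suc : ∀ m → within G m x y ≡ true → within G (suc m) x y ≡ true
  within-suc {x} {y} m e = cong (_∨ any (λ z → within G m x z ∧ adj G z y) (allFin (n G))) e

  within-refl : ∀ m x → within G m x x ≡ true
  within-refl 0       x = trans (isYes≗does (x ≟ x)) (dec-true (x ≟ x) refl)
  within-refl (suc m) x = within-suc m (within-refl m x)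

  within-step : ∀ m → within G m x z ≡ true → adj G z y ≡ true → within G (suc m) x y ≡ true
  within-step {x} {z} {y} m xz zy =
    trans (cong (within G m x y ∨_) (any-intro (∈-allFin z) (cong₂ _∧_ xz zy))) (∨-zeroʳ _)

  within-suc-inv : ∀ m → within G (suc m) x y ≡ true →
                   within G m x y ≡ true ⊎ Σ (V G) (λ z → within G m x z ≡ true × adj G z y ≡ true)
  within-suc-inv {x} {y} m e with within G m x y
  ... | true  = inj₁ refl
  ... | false with z , xzy ← any-elim (allFin (n G)) e = inj₂ (z , ∧≡true⇒both xzy)

  atDist-suc-intro : ∀ i → within G (suc i) x y ≡ true → within G i x y ≡ false →
                     atDist G (suc i) x y ≡ true
  atDist-suc-intro _ = cong₂ (λ u v → u ∧ not v)

  atDist-suc-elim : ∀ i → atDist G (suc i) x y ≡ true →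
                    within G (suc i) x y ≡ true × within G i x y ≡ false
  atDist-suc-elim _ e with w , nw ← ∧≡true⇒both e = w , not-injective nw

  atDist-suc⇒≢ : ∀ i → atDist G (suc i) x y ≡ true → x ≢ y
  atDist-suc⇒≢ {x} i e refl =
    true≢false (trans (sym (within-refl i x)) (proj₂ (atDist-suc-elim i e)))

  adj⇒atDist-1 : adj G x y ≡ true → atDist G 1 x y ≡ true
  adj⇒atDist-1 {x} e =
    atDist-suc-intro 0 (within-step 0 (within-refl 0 x) e) (¬-not (adj⇒≢ e ∘ within-0⇒≡))

  atDist-1⇒adj : atDist G 1 x y ≡ true → adj G x y ≡ true
  atDist-1⇒adj {x} {y} e with within-suc-inv {x} {y} 0 (proj₁ (atDist-suc-elim 0 e))
  ... | inj₁ w₀ = contradiction (within-0⇒≡ w₀) (atDist-suc⇒≢ 0 e)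
  ... | inj₂ (z , w₀ , zy) with refl ← within-0⇒≡ {x} {z} w₀ = zy

  atDist-1≡adj : ∀ x y → atDist G 1 x y ≡ adj G x y
  atDist-1≡adj x y with adj G x y in e
  ... | true  = adj⇒atDist-1 e
  ... | false = ¬-not λ d → true≢false (trans (sym (atDist-1⇒adj d)) e)

  atDist-pred : ∀ i → atDist G (suc i) x y ≡ true →
                Σ (V G) (λ z → atDist G i x z ≡ true × adj G z y ≡ true)
  atDist-pred {x} 0 e = x , within-refl 0 x , atDist-1⇒adj e
  atDist-pred (suc i) e with w , nw ← atDist-suc-elim (suc i) e | within-suc-inv (suc i) w
  ... | inj₁ w′ = contradiction (trans (sym w′) nw) true≢false
  ... | inj₂ (z , xz , zy) =
    z , atDist-suc-intro i xz (¬-not λ w → true≢false (trans (sym (within-step i w zy)) nw)) , zy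

  atDist-descend : j ≤ i → atDist G i x y ≡ true → Σ (V G) (λ z → atDist G j x z ≡ true)
  atDist-descend {y = y} j≤i e with m≤n⇒m<n∨m≡n j≤i
  ... | inj₂ refl = y , e
  ... | inj₁ (s≤s {n = i′} j≤i′) = atDist-descend j≤i′ (proj₁ (proj₂ (atDist-pred {y = y} i′ e)))

  adj-adj⇒within-2 : adj G x z ≡ true → adj G z y ≡ true → within G 2 x y ≡ true
  adj-adj⇒within-2 {x} xz zy = within-step 1 (within-step 0 (within-refl 0 x) xz) zy

  E12⇒within-2 : E12 G x y → within G 2 x y ≡ true
  E12⇒within-2 {x} (inj₁ xy) = within-suc 1 (within-step 0 (within-refl 0 x) xy)
  E12⇒within-2 (inj₂ d₂)     = proj₁ (atDist-suc-elim 1 d₂)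

  adj⇒¬E2 : adj G x y ≡ true → ¬ E2 G x y
  adj⇒¬E2 {x} xy d₂ =
    true≢false (trans (sym (within-step 0 (within-refl 0 x) xy)) (proj₂ (atDist-suc-elim 1 d₂)))

  commonNbrs-zero : within G 2 x y ≡ false → commonNbrs G x y ≡ 0
  commonNbrs-zero {x} {y} far = count-zero λ z → ¬-not λ xzy →
    let xz , yz = ∧≡true⇒both xzy in
    true≢false (trans (sym (adj-adj⇒within-2 xz (trans (Graph.sym G z y) yz))) far)

  E2⇒commonNbrs≢0 : E2 G x y → commonNbrs G x y ≢ 0
  E2⇒commonNbrs≢0 {x} {y} d₂ with z , d₁ , zy ← atDist-pred {x} {y} 1 d₂ =
    count≢0 z (cong₂ _∧_ (atDist-1⇒adj {x} d₁) (trans (Graph.sym G y z) zy))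

  commonNbrs≡count-atDist-1 : ∀ x y → commonNbrs G x y ≡ count (λ z → adj G y z ∧ atDist G 1 x z)
  commonNbrs≡count-atDist-1 x y = count-cong λ z →
    trans (∧-comm (adj G x z) (adj G y z)) (cong (adj G y z ∧_) (sym (atDist-1≡adj x z)))

  far⇒¬E12 : within G 2 x y ≡ false → ¬ E12 G x y
  far⇒¬E12 far r = true≢false (trans (sym (E12⇒within-2 r)) far)

  ≢-¬adj⇒¬within-1 : x ≢ y → adj G x y ≡ false → ¬ within G 1 x y ≡ true
  ≢-¬adj⇒¬within-1 {x} {y} x≢y xy w with within-suc-inv {x} {y} 0 w
  ... | inj₁ w₀ = x≢y (within-0⇒≡ w₀)
  ... | inj₂ (z , w₀ , zy) with refl ← within-0⇒≡ {x} {z} w₀ = true≢false (trans (sym zy) xy)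

  distinct-trichotomy : x ≢ y → adj G x y ≡ true ⊎ E2 G x y ⊎ within G 2 x y ≡ false
  distinct-trichotomy {x} {y} x≢y with adj G x y in xy | atDist G 2 x y in d₂
  ... | true  | _     = inj₁ refl
  ... | false | true  = inj₂ (inj₁ refl)
  ... | false | false = inj₂ (inj₂ (¬-not λ w₂ →
    true≢false (trans (sym (atDist-suc-intro 1 w₂ (¬-not (≢-¬adj⇒¬within-1 x≢y xy)))) d₂)))

  TwoValuedOn : ℕ → (V G → V G → Set) → Set
  TwoValuedOn m R = ∀ x y → x ≢ y →
    (R x y × commonNbrs G x y ≡ m) ⊎ (¬ R x y × commonNbrs G x y ≡ 0)

  module _ {m : ℕ} {R : V G → V G → Set} (twoValued : TwoValuedOn m R) where

    twoValued⇒isDeza : ∀ {k} → (∀ x → degree G x ≡ k) → ¬ Complete G → ¬ Edgeless G →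
                       IsDeza G k m 0
    twoValued⇒isDeza regular ¬complete ¬edgeless =
      z≤n , regular , ¬complete , ¬edgeless , λ x y x≢y → case twoValued x y x≢y of λ where
        (inj₁ (_ , cn)) → inj₁ cn
        (inj₂ (_ , cn)) → inj₂ cn

    twoValued⇒child-m : m ≢ 0 → (∀ {x y} → R x y → x ≢ y) → SameRel G (Child G m) R
    twoValued⇒child-m m≢0 irreflexive x y = mk⇔ to from
      where
      to : Child G m x y → R x y
      to (x≢y , cn) with twoValued x y x≢y
      ... | inj₁ (r , _)   = r
      ... | inj₂ (_ , cn₀) = contradiction (trans (sym cn) cn₀) m≢0
      from : R x y → Child G m x y
      from r with twoValued x y (irreflexive r)
      ... | inj₁ (_ , cn) = irreflexive r , cn
      ... | inj₂ (¬r , _) = contradiction r ¬r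

    twoValued⇒child-0 : m ≢ 0 → SameRel G (Child G 0) (Compl G R)
    twoValued⇒child-0 m≢0 x y = mk⇔ to from
      where
      to : Child G 0 x y → Compl G R x y
      to (x≢y , cn₀) with twoValued x y x≢y
      ... | inj₁ (_ , cn) = contradiction (trans (sym cn) cn₀) m≢0
      ... | inj₂ (¬r , _) = x≢y , ¬r
      from : Compl G R x y → Child G 0 x y
      from (x≢y , ¬r) with twoValued x y x≢y
      ... | inj₁ (r , _)   = contradiction r ¬r
      ... | inj₂ (_ , cn₀) = x≢y , cn₀

two-values-pigeonhole : {p q r u v : A} → p ≡ u ⊎ p ≡ v → q ≡ u ⊎ q ≡ v → r ≡ u ⊎ r ≡ v → q ≢ r →
               p ≡ q ⊎ p ≡ r
two-values-pigeonhole (inj₁ p≡u) (inj₁ q≡u) _          _   = inj₁ (trans p≡u (sym q≡u))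
two-values-pigeonhole (inj₂ p≡v) (inj₂ q≡v) _          _   = inj₁ (trans p≡v (sym q≡v))
two-values-pigeonhole (inj₁ p≡u) (inj₂ _)   (inj₁ r≡u) _   = inj₂ (trans p≡u (sym r≡u))
two-values-pigeonhole (inj₂ p≡v) (inj₁ _)   (inj₂ r≡v) _   = inj₂ (trans p≡v (sym r≡v))
two-values-pigeonhole (inj₁ _)   (inj₂ q≡v) (inj₂ r≡v) q≢r = contradiction (trans q≡v (sym r≡v)) q≢r
two-values-pigeonhole (inj₂ _)   (inj₁ q≡u) (inj₁ r≡u) q≢r = contradiction (trans q≡u (sym r≡u)) q≢r

module DistanceRegular (G : Graph) (d : ℕ) (a b c : ℕ → ℕ) (drg : IsDRG G d a b c) where
  private
    variable
      x y : V G

    diameter : ConnectedDiameter G d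
    diameter = proj₁ drg

    b-a-counts : ∀ i x y → i ≤ d → atDist G i x y ≡ true →
                 (count (λ z → adj G y z ∧ atDist G (suc i) x z) ≡ b i)
               × (count (λ z → adj G y z ∧ atDist G i x z) ≡ a i)
    b-a-counts = proj₁ (proj₂ drg)

    c-counts : ∀ i x y → suc i ≤ d → atDist G (suc i) x y ≡ true →
               count (λ z → adj G y z ∧ atDist G i x z) ≡ c (suc i)
    c-counts = proj₁ (proj₂ (proj₂ drg))

  degree≡b₀ : ∀ x → degree G x ≡ b 0
  degree≡b₀ x = trans (count-cong adj≡adj∧atDist-1) (proj₁ (b-a-counts 0 x x z≤n (within-refl G 0 x)))
    where
    adj≡adj∧atDist-1 : ∀ z → adj G x z ≡ adj G x z ∧ atDist G 1 x z
    adj≡adj∧atDist-1 z = trans (sym (∧-idem (adj G x z))) (cong (adj G x z ∧_) (sym (atDist-1≡adj G x z)))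

  commonNbrs-adj : 1 ≤ d → adj G x y ≡ true → commonNbrs G x y ≡ a 1
  commonNbrs-adj {x} {y} 1≤d xy =
    trans (commonNbrs≡count-atDist-1 G x y) (proj₂ (b-a-counts 1 x y 1≤d (adj⇒atDist-1 G xy)))

  commonNbrs-E2 : 2 ≤ d → E2 G x y → commonNbrs G x y ≡ c 2
  commonNbrs-E2 {x} {y} 2≤d d₂ = trans (commonNbrs≡count-atDist-1 G x y) (c-counts 1 x y 2≤d d₂)

  ∃-atDist : ∀ {j} → j ≤ d → Σ (V G) λ x → Σ (V G) λ y → atDist G j x y ≡ true
  ∃-atDist j≤d with x , y , dd ← proj₂ diameter with z , dj ← atDist-descend G j≤d dd = x , z , dj

  c₂≢0 : 2 ≤ d → c 2 ≢ 0
  c₂≢0 2≤d with x , y , d₂ ← ∃-atDist 2≤d =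
    E2⇒commonNbrs≢0 G {x} {y} d₂ ∘ trans (commonNbrs-E2 2≤d d₂)

  ¬edgeless : 1 ≤ d → ¬ Edgeless G
  ¬edgeless 1≤d edgeless with x , y , d₁ ← ∃-atDist 1≤d =
    true≢false (trans (sym (atDist-1⇒adj G d₁)) (edgeless x y))

  ¬complete : 2 ≤ d → ¬ Complete G
  ¬complete 2≤d complete with x , y , d₂ ← ∃-atDist 2≤d =
    adj⇒¬E2 G (complete x y (atDist-suc⇒≢ G 1 d₂)) d₂

  twoValued-E2 : 2 ≤ d → a 1 ≡ 0 → TwoValuedOn G (c 2) (E2 G)
  twoValued-E2 2≤d a₁≡0 x y x≢y with distinct-trichotomy G x≢y
  ... | inj₁ xy         = inj₂ (adj⇒¬E2 G xy , trans (commonNbrs-adj (<⇒≤ 2≤d) xy) a₁≡0)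
  ... | inj₂ (inj₁ d₂)  = inj₁ (d₂ , commonNbrs-E2 2≤d d₂)
  ... | inj₂ (inj₂ far) = inj₂ ((λ d₂ → far⇒¬E12 G far (inj₂ d₂)) , commonNbrs-zero G far)

  twoValued-E12 : 2 ≤ d → a 1 ≡ c 2 → TwoValuedOn G (c 2) (E12 G)
  twoValued-E12 2≤d a₁≡c₂ x y x≢y with distinct-trichotomy G x≢y
  ... | inj₁ xy         = inj₁ (inj₁ xy , trans (commonNbrs-adj (<⇒≤ 2≤d) xy) a₁≡c₂)
  ... | inj₂ (inj₁ d₂)  = inj₁ (inj₂ d₂ , commonNbrs-E2 2≤d d₂)
  ... | inj₂ (inj₂ far) = inj₂ (far⇒¬E12 G far , commonNbrs-zero G far)

  DezaWithChildren : (V G → V G → Set) → Set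
  DezaWithChildren R =
    IsDeza G (b 0) (c 2) 0 × SameRel G (Child G (c 2)) R × SameRel G (Child G 0) (Compl G R)

  twoValued⇒dezaWithChildren : ∀ {R} → 2 ≤ d → (∀ {x y} → R x y → x ≢ y) →
                               TwoValuedOn G (c 2) R → DezaWithChildren R
  twoValued⇒dezaWithChildren 2≤d irreflexive twoValued =
    twoValued⇒isDeza G twoValued degree≡b₀ (¬complete 2≤d) (¬edgeless (<⇒≤ 2≤d)) ,
    twoValued⇒child-m G twoValued (c₂≢0 2≤d) irreflexive ,
    twoValued⇒child-0 G twoValued (c₂≢0 2≤d)

  a₁≡0⇒dezaWithChildren-E2 : 2 ≤ d → a 1 ≡ 0 → DezaWithChildren (E2 G)
  a₁≡0⇒dezaWithChildren-E2 2≤d =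
    twoValued⇒dezaWithChildren 2≤d (atDist-suc⇒≢ G 1) ∘ twoValued-E2 2≤d

  a₁≡c₂⇒dezaWithChildren-E12 : 2 ≤ d → a 1 ≡ c 2 → DezaWithChildren (E12 G)
  a₁≡c₂⇒dezaWithChildren-E12 2≤d =
    twoValued⇒dezaWithChildren 2≤d [ adj⇒≢ G , atDist-suc⇒≢ G 1 ] ∘ twoValued-E12 2≤d

  a₁∈[0,c₂]⇒isDezaGraph : 2 ≤ d → a 1 ≡ 0 ⊎ a 1 ≡ c 2 → IsDezaGraph G
  a₁∈[0,c₂]⇒isDezaGraph 2≤d (inj₁ a₁≡0)  = b 0 , c 2 , 0 , proj₁ (a₁≡0⇒dezaWithChildren-E2 2≤d a₁≡0)
  a₁∈[0,c₂]⇒isDezaGraph 2≤d (inj₂ a₁≡c₂) = b 0 , c 2 , 0 , proj₁ (a₁≡c₂⇒dezaWithChildren-E12 2≤d a₁≡c₂)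

  isDezaGraph⇒a₁∈[0,c₂] : 3 ≤ d → IsDezaGraph G → a 1 ≡ 0 ⊎ a 1 ≡ c 2
  isDezaGraph⇒a₁∈[0,c₂] 3≤d (_ , u , v , _ , _ , _ , _ , twoValues) =
    let x₁ , y₁ , d₁ = ∃-atDist 1≤d
        x₂ , y₂ , d₂ = ∃-atDist 2≤d
        x₃ , y₃ , d₃ = ∃-atDist 3≤d
    in two-values-pigeonhole
      (valueAt (atDist-suc⇒≢ G 0 d₁) (commonNbrs-adj 1≤d (atDist-1⇒adj G {x₁} {y₁} d₁)))
      (valueAt (atDist-suc⇒≢ G 2 d₃) (commonNbrs-zero G (proj₂ (atDist-suc-elim G {x₃} {y₃} 2 d₃))))
      (valueAt (atDist-suc⇒≢ G 1 d₂) (commonNbrs-E2 {x₂} {y₂} 2≤d d₂))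
      (c₂≢0 2≤d ∘ sym)
    where
    2≤d : 2 ≤ d
    2≤d = <⇒≤ 3≤d
    1≤d : 1 ≤ d
    1≤d = <⇒≤ 2≤d
    valueAt : ∀ {x y t} → x ≢ y → commonNbrs G x y ≡ t → t ≡ u ⊎ t ≡ v
    valueAt {x} {y} x≢y refl = twoValues x y x≢y

proposition2 : (G : Graph) (d : ℕ) (a b c : ℕ → ℕ) → 3 ≤ d → IsDRG G d a b c →
    (IsDezaGraph G ⇔ (a 1 ≡ 0 ⊎ a 1 ≡ c 2))
    × (a 1 ≡ 0 → IsDeza G (b 0) (c 2) 0
                 × SameRel G (Child G (c 2)) (E2 G)
                 × SameRel G (Child G 0) (Compl G (E2 G)))
    × (a 1 ≡ c 2 → IsDeza G (b 0) (c 2) 0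
                 × SameRel G (Child G (c 2)) (E12 G)
                 × SameRel G (Child G 0) (Compl G (E12 G)))
proposition2 G d a b c 3≤d drg =
  mk⇔ (isDezaGraph⇒a₁∈[0,c₂] 3≤d) (a₁∈[0,c₂]⇒isDezaGraph 2≤d) ,
  a₁≡0⇒dezaWithChildren-E2 2≤d ,
  a₁≡c₂⇒dezaWithChildren-E12 2≤d
  where
  open DistanceRegular G d a b c drg
  2≤d : 2 ≤ d
  2≤d = <⇒≤ 3≤d
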